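{- Let $D$ be a digraph such that every proper induced subdigraph of $D$ satisfies the BE-property (resp. the $\alpha$-property), and let $S$ be a maximum stable set of $D$. If $V(D)$ admits a partition $(V_1,V_2,V_3)$ such that $V_1\mapsto V_2\mapsto V_3$, $D[V_2]$ is hamiltonian, $|V_2|\ge 2$ and $|V_2\cap S|\le 1$, then $D$ admits an $S_{BE}$-path partition (resp. an $S$-path partition).
   Context: Digraphs are finite, loopless, without multiple arcs (digons allowed). For disjoint vertex sets $X,Y$, $X\mapsto Y$ means every vertex of $X$ dominates (has an arc to) every vertex of $Y$ and there is no arc from $Y$ to $X$. $D[X]$ is hamiltonian if it has a directed cycle through all vertices of $X$. A stable set is a set of pairwise non-adjacent vertices. A path partition is a collection of vertex-disjoint (directed) paths covering $V(D)$. For a stable set $S$, an $S$-path partition is a path partition in which each path contains exactly one vertex of $S$; an $S_{BE}$-path partition is an $S$-path partition in which additionally every vertex of $S$ is the first or last vertex of its path. A digraph satisfies the $\alpha$-property (resp. BE-property) if for every maximum stable set $S$ it admits an $S$-path partition (resp. $S_{BE}$-path partition). -}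

module Defs where

open import Data.Nat using (ℕ; _≤_)
open import Data.Fin using (Fin)
open import Data.Fin.Subset using (Subset; _∈_; _∉_; _⊆_; _⊂_; _∩_; ∣_∣; ⊤)
open import Data.List using (List; []; _∷_; concat; head; last)
open import Data.List.Relation.Unary.Unique.Propositional using (Unique)
open import Data.List.Relation.Unary.All using (All)
open import Data.List.Relation.Unary.Linked using (Linked)
import Data.List.Membership.Propositional as LM
open import Data.Maybe using (just)
open import Data.Product using (Σ; ∃; _×_; _,_)
open import Data.Sum using (_⊎_)
open import Relation.Nullary using (¬_)
open import Relation.Binary.PropositionalEquality using (_≡_)
open import Relation.Binary using (Decidable)
open import Function.Bundles using (_⇔_)

-- A finite digraph on vertex set Fin n: loopless, no multiple arcs (arcs form a relation),
-- digons allowed.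
record Digraph (n : ℕ) : Set₁ where
  field
    Arc      : Fin n → Fin n → Set
    loopless : ∀ v → ¬ Arc v v
    arc?     : Decidable Arc

module _ {n : ℕ} (D : Digraph n) where
  open Digraph D

  Stable : Subset n → Subset n → Set
  Stable X S = S ⊆ X × (∀ u v → u ∈ S → v ∈ S → ¬ Arc u v)

  MaxStable : Subset n → Subset n → Set
  MaxStable X S = Stable X S × (∀ T → Stable X T → ∣ T ∣ ≤ ∣ S ∣)

  IsPath : List (Fin n) → Set
  IsPath P = ¬ (P ≡ []) × Unique P × Linked Arc P

  ExactlyCovers : List (Fin n) → Subset n → Set
  ExactlyCovers L X = Unique L × (∀ v → (v LM.∈ L) ⇔ (v ∈ X))

  PathPartition : Subset n → List (List (Fin n)) → Set
  PathPartition X Ps = All IsPath Ps × ExactlyCovers (concat Ps) X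

  UniqueSIn : Subset n → List (Fin n) → Fin n → Set
  UniqueSIn S P s = s ∈ S × s LM.∈ P × (∀ t → t ∈ S → t LM.∈ P → t ≡ s)

  SPathPartition : Subset n → Subset n → List (List (Fin n)) → Set
  SPathPartition X S Ps =
    PathPartition X Ps × All (λ P → ∃ λ s → UniqueSIn S P s) Ps

  SBEPathPartition : Subset n → Subset n → List (List (Fin n)) → Set
  SBEPathPartition X S Ps =
    PathPartition X Ps ×
    All (λ P → ∃ λ s → UniqueSIn S P s × (head P ≡ just s ⊎ last P ≡ just s)) Ps

  AlphaProperty : Subset n → Set
  AlphaProperty X = ∀ S → MaxStable X S → ∃ λ Ps → SPathPartition X S Ps

  BEProperty : Subset n → Set
  BEProperty X = ∀ S → MaxStable X S → ∃ λ Ps → SBEPathPartition X S Ps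

  AllProperSub : (Subset n → Set) → Set
  AllProperSub Prop = ∀ X → X ⊂ ⊤ → Prop X

  _↦_ : Subset n → Subset n → Set
  X ↦ Y = ∀ u v → u ∈ X → v ∈ Y → Arc u v × ¬ Arc v u

  Hamiltonian : Subset n → Set
  Hamiltonian X = ∃ λ C → ExactlyCovers C X × Linked Arc C ×
    (∃ λ a → ∃ λ b → head C ≡ just a × last C ≡ just b × Arc b a)

  -- (V₁,V₂,V₃) is a partition of V(D) (parts may be empty)
  Partition3 : Subset n → Subset n → Subset n → Set
  Partition3 V₁ V₂ V₃ = ∀ v →
    (v ∈ V₁ × v ∉ V₂ × v ∉ V₃) ⊎ (v ∉ V₁ × v ∈ V₂ × v ∉ V₃) ⊎ (v ∉ V₁ × v ∉ V₂ × v ∈ V₃)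

  Hyp : Subset n → Subset n → Subset n → Subset n → Set
  Hyp S V₁ V₂ V₃ =
    MaxStable ⊤ S × Partition3 V₁ V₂ V₃ × V₁ ↦ V₂ × V₂ ↦ V₃ ×
    Hamiltonian V₂ × 2 ≤ ∣ V₂ ∣ × ∣ V₂ ∩ S ∣ ≤ 1

{-# OPTIONS --safe #-}
-- The middle part V₂ is a module of D: a vertex outside V₂ (necessarily in V₁ or V₃) with an arc
-- to, resp. from, one vertex of V₂ has such an arc to, resp. from, every vertex of V₂. As
-- ∣V₂ ∩ S∣ ≤ 1, some v ∈ V₂ is the only vertex of V₂ that may lie in S, so S is still a maximum
-- stable set of the proper subdigraph D − (V₂ − v), which has the property. In its path
-- partition, replace v by a hamiltonian path of D[V₂], obtained by rotating the hamiltonian cycle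
-- so that it starts at v (or ends at v, when the S-vertex of the path of v has to stay last). The
-- module property keeps the spliced path directed, and no new vertex of S appears.
module Submission where

open import Defs
open import Data.Nat using (ℕ; _≤_; _<_)
open import Data.Nat.Properties using (<⇒≱; >⇒≢; <⇒≤)
open import Data.Fin using (Fin; _≟_)
open import Data.Fin.Properties using (any?)
open import Data.Fin.Subset
  using (Subset; ⊤; ∁; _∪_; _∩_; ⁅_⁆; ∣_∣; _⊆_; _⊂_; Nonempty)
  renaming (_∈_ to _∈ₛ_; _∉_ to _∉ₛ_)
open import Data.Fin.Subset.Properties
  using (_∈?_; ∈⊤; x∈p∪q⁺; x∈p∪q⁻; x∈p∩q⁺; x∈p∩q⁻; x∈∁p⇒x∉p; x∉p⇒x∈∁p; x∈⁅x⁆; x∈⁅y⁆⇒x≡y;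
         x≢y⇒x∉⁅y⁆; ∣⁅x⁆∣≡1; p⊆q⇒∣p∣≤∣q∣; p⊂q⇒∣p∣<∣q∣; nonempty?; Empty-unique; ∣⊥∣≡0)
open import Data.List using (List; []; _∷_; _++_; [_]; concat; head; last)
open import Data.List.Properties
  using (++-assoc; ++-identityʳ; ++-conicalˡ; ++-conicalʳ; concat-++)
open import Data.List.Membership.Propositional using (_∈_; _∉_; find)
open import Data.List.Membership.Propositional.Properties
  using (∈-++⁺ˡ; ∈-++⁺ʳ; ∈-++⁻; ∈-∃++; ∈-concat⁻)
open import Data.List.Relation.Unary.Any using (here; there)
import Data.List.Relation.Unary.Any.Properties as Any
open import Data.List.Relation.Unary.All as All using (All; []; _∷_)
import Data.List.Relation.Unary.All.Properties as All
open import Data.List.Relation.Unary.Unique.Propositional using (Unique; []; _∷_)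
import Data.List.Relation.Unary.Unique.Propositional.Properties as Unique
open import Data.List.Relation.Binary.Disjoint.Propositional using (Disjoint)
import Data.List.Relation.Binary.Disjoint.Propositional.Properties as Disjoint
open import Data.List.Relation.Unary.Linked as Linked using (Linked; []; [-]; _∷_)
import Data.List.Relation.Unary.Linked.Properties as Linked
open import Data.Maybe using (just; nothing)
open import Data.Maybe.Relation.Binary.Connected
  using (Connected; just; just-nothing; nothing-just; nothing)
open import Data.Product using (∃; _×_; _,_; proj₁; proj₂)
open import Data.Sum using (_⊎_; inj₁; inj₂; [_,_]′)
open import Function using (_∘_)
open import Function.Bundles using (Equivalence; _⇔_; mk⇔)
open import Relation.Binary.Core using (Rel)
open import Relation.Nullary using (yes; no; ¬?; contradiction)
open import Relation.Nullary.Decidable using (_×-dec_)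
open import Relation.Binary.PropositionalEquality
  using (_≡_; _≢_; refl; sym; trans; cong; subst; subst₂; module ≡-Reasoning)

open Equivalence using (to; from)

module _ {a} {A : Set a} where

  last-++-∷ : ∀ xs {y : A} ys → last (xs ++ y ∷ ys) ≡ last (y ∷ ys)
  last-++-∷ []           ys = refl
  last-++-∷ (_ ∷ [])     ys = refl
  last-++-∷ (_ ∷ x ∷ xs) ys = last-++-∷ (x ∷ xs) ys

  last-∈ : ∀ xs {x : A} → last xs ≡ just x → x ∈ xs
  last-∈ (_ ∷ [])     refl = here refl
  last-∈ (_ ∷ y ∷ ys) eq   = there (last-∈ (y ∷ ys) eq)

  ∈-++-∷⁺ : ∀ xs {v w : A} {ys} → w ∈ xs ++ ys → w ∈ xs ++ v ∷ ys
  ∈-++-∷⁺ xs w∈ = [ ∈-++⁺ˡ , ∈-++⁺ʳ xs ∘ there ]′ (∈-++⁻ xs w∈)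

  ∈-splice⁺ : ∀ xs {v w : A} {ys zs} → v ∈ zs → w ∈ xs ++ v ∷ ys → w ∈ xs ++ zs ++ ys
  ∈-splice⁺ xs v∈zs w∈ with ∈-++⁻ xs w∈
  ... | inj₁ w∈xs         = ∈-++⁺ˡ w∈xs
  ... | inj₂ (here refl)  = ∈-++⁺ʳ xs (∈-++⁺ˡ v∈zs)
  ... | inj₂ (there w∈ys) = ∈-++⁺ʳ xs (∈-++⁺ʳ _ w∈ys)

  ∈-splice⁻ : ∀ xs {w : A} {ys} zs → w ∈ xs ++ zs ++ ys → w ∈ xs ++ ys ⊎ w ∈ zs
  ∈-splice⁻ xs zs w∈ with ∈-++⁻ xs w∈
  ... | inj₁ w∈xs = inj₁ (∈-++⁺ˡ w∈xs)
  ... | inj₂ w∈zsys = [ inj₂ , inj₁ ∘ ∈-++⁺ʳ xs ]′ (∈-++⁻ zs w∈zsys)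

  Unique-++⁻ : ∀ xs {ys : List A} → Unique (xs ++ ys) → Unique xs × Unique ys × Disjoint xs ys
  Unique-++⁻ []       u = [] , u , λ ()
  Unique-++⁻ (x ∷ xs) (x∉ ∷ u) with Unique-++⁻ xs u
  ... | uxs , uys , xs#ys = All.++⁻ˡ xs x∉ ∷ uxs , uys , λ where
    (here refl , y∈ys) → All.lookup (All.++⁻ʳ xs x∉) y∈ys refl
    (there y∈xs , y∈ys) → xs#ys (y∈xs , y∈ys)

  Unique-++-comm : ∀ xs {ys : List A} → Unique (xs ++ ys) → Unique (ys ++ xs)
  Unique-++-comm xs u with Unique-++⁻ xs u
  ... | uxs , uys , xs#ys = Unique.++⁺ uys uxs (Disjoint.sym xs#ys)

  Unique-++-∷⇒∉ : ∀ xs {v : A} {ys} → Unique (xs ++ v ∷ ys) → v ∉ xs ++ ys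
  Unique-++-∷⇒∉ xs u v∈ with Unique-++⁻ xs u | ∈-++⁻ xs v∈
  ... | _ , _ , xs#vys | inj₁ v∈xs = xs#vys (v∈xs , here refl)
  ... | _ , v∉ys ∷ _ , _ | inj₂ v∈ys = All.lookup v∉ys v∈ys refl

  Unique-splice : ∀ xs {v : A} {ys zs} → Unique (xs ++ v ∷ ys) → Unique zs →
                  Disjoint (xs ++ ys) zs → Unique (xs ++ zs ++ ys)
  Unique-splice xs {ys = ys} {zs} u uzs xsys#zs with Unique-++⁻ xs u
  ... | uxs , _ ∷ uys , xs#vys =
    Unique.++⁺ uxs (Unique.++⁺ uzs uys zs#ys) xs#zsys
    where
    zs#ys : Disjoint zs ys
    zs#ys (w∈zs , w∈ys) = xsys#zs (∈-++⁺ʳ xs w∈ys , w∈zs)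
    xs#zsys : Disjoint xs (zs ++ ys)
    xs#zsys (w∈xs , w∈zsys) with ∈-++⁻ zs w∈zsys
    ... | inj₁ w∈zs = xsys#zs (∈-++⁺ˡ w∈xs , w∈zs)
    ... | inj₂ w∈ys = xs#vys (w∈xs , there w∈ys)

  head-splice : ∀ xs {v : A} {ys zs} → head zs ≡ just v →
                head (xs ++ zs ++ ys) ≡ head (xs ++ v ∷ ys)
  head-splice []      {zs = _ ∷ _} refl = refl
  head-splice (_ ∷ _) _                 = refl

  last-splice : ∀ xs {v : A} ys {zs} → last zs ≡ just v →
                last (xs ++ zs ++ ys) ≡ last (xs ++ v ∷ ys)
  last-splice xs {v} [] {z ∷ zs} lz = begin
    last (xs ++ (z ∷ zs) ++ [])  ≡⟨ cong (last ∘ (xs ++_)) (++-identityʳ (z ∷ zs)) ⟩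
    last (xs ++ z ∷ zs)          ≡⟨ last-++-∷ xs zs ⟩
    last (z ∷ zs)                ≡⟨ lz ⟩
    just v                       ≡⟨ last-++-∷ xs [] ⟨
    last (xs ++ [ v ])           ∎
    where open ≡-Reasoning
  last-splice xs {v} (y ∷ ys) {z ∷ zs} _ = begin
    last (xs ++ z ∷ zs ++ y ∷ ys)  ≡⟨ last-++-∷ xs (zs ++ y ∷ ys) ⟩
    last (z ∷ zs ++ y ∷ ys)        ≡⟨ last-++-∷ (z ∷ zs) ys ⟩
    last (y ∷ ys)                  ≡⟨ last-++-∷ xs (y ∷ ys) ⟨
    last (xs ++ v ∷ y ∷ ys)        ∎
    where open ≡-Reasoning

  concat-splice : ∀ (xss : List (List A)) xs zs ys yss →
                  concat (xss ++ (xs ++ zs ++ ys) ∷ yss) ≡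
                  (concat xss ++ xs) ++ zs ++ (ys ++ concat yss)
  concat-splice xss xs zs ys yss = begin
    concat (xss ++ (xs ++ zs ++ ys) ∷ yss)          ≡⟨ concat-++ xss _ ⟨
    concat xss ++ (xs ++ zs ++ ys) ++ concat yss    ≡⟨ cong (concat xss ++_) (++-assoc xs _ _) ⟩
    concat xss ++ xs ++ (zs ++ ys) ++ concat yss    ≡⟨ cong ((concat xss ++_) ∘ (xs ++_)) (++-assoc zs ys _) ⟩
    concat xss ++ xs ++ zs ++ ys ++ concat yss      ≡⟨ ++-assoc (concat xss) xs _ ⟨
    (concat xss ++ xs) ++ zs ++ ys ++ concat yss    ∎
    where open ≡-Reasoning

  ∈-concat⇒split : ∀ {v : A} xss → v ∈ concat xss →
                   ∃ λ xss₁ → ∃ λ yss → ∃ λ xs → ∃ λ ys → xss ≡ xss₁ ++ (xs ++ v ∷ ys) ∷ yss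
  ∈-concat⇒split xss v∈ with find (∈-concat⁻ xss v∈)
  ... | zs , zs∈xss , v∈zs with ∈-∃++ zs∈xss | ∈-∃++ v∈zs
  ... | xss₁ , yss , refl | xs , ys , refl = xss₁ , yss , xs , ys , refl

  All-replace : ∀ {p} {P : List A → Set p} xss {xs ys yss} →
                All P (xss ++ xs ∷ yss) → P ys → All P (xss ++ ys ∷ yss)
  All-replace xss all pys with All.++⁻ xss all
  ... | pxss , _ ∷ pyss = All.++⁺ pxss (pys ∷ pyss)

  module _ {ℓ} {R : Rel A ℓ} where

    Connected-nothingˡ : ∀ {m} → Connected R nothing m
    Connected-nothingˡ {just _}  = nothing-just
    Connected-nothingˡ {nothing} = nothing

    Connected-nothingʳ : ∀ {m} → Connected R m nothing
    Connected-nothingʳ {just _}  = just-nothing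
    Connected-nothingʳ {nothing} = nothing

    Linked-++⁻ : ∀ xs {ys} → Linked R (xs ++ ys) →
                 Linked R xs × Connected R (last xs) (head ys) × Linked R ys
    Linked-++⁻ []                 l          = [] , Connected-nothingˡ , l
    Linked-++⁻ (x ∷ []) {[]}      l          = [-] , just-nothing , []
    Linked-++⁻ (x ∷ []) {_ ∷ _}   (r ∷ l)    = [-] , just r , l
    Linked-++⁻ (x ∷ x′ ∷ xs)      (r ∷ l) with Linked-++⁻ (x′ ∷ xs) l
    ... | lxs , c , lys = r ∷ lxs , c , lys

    Linked-rotate : ∀ xs {ys} → Linked R (xs ++ ys) →
                    Connected R (last (xs ++ ys)) (head (xs ++ ys)) → Linked R (ys ++ xs)
    Linked-rotate xs {ys} l closing with Linked-++⁻ xs l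
    ... | lxs , _ , lys = Linked.++⁺ lys (wrap xs ys closing) lxs
      where
      wrap : ∀ xs ys → Connected R (last (xs ++ ys)) (head (xs ++ ys)) →
             Connected R (last ys) (head xs)
      wrap []      _        _ = Connected-nothingʳ
      wrap (_ ∷ _) []       _ = Connected-nothingˡ
      wrap (x ∷ xs) (y ∷ ys) c = subst (λ m → Connected R m (just x)) (last-++-∷ (x ∷ xs) ys) c

    Linked-splice : ∀ xs {v} ys {zs} → Linked R (xs ++ v ∷ ys) → Linked R zs → zs ≢ [] →
                    (∀ {x z} → x ∈ xs → z ∈ zs → R x v → R x z) →
                    (∀ {y z} → y ∈ ys → z ∈ zs → R v y → R z y) →
                    Linked R (xs ++ zs ++ ys)
    Linked-splice xs ys {[]} _ _ zs≢[] _ _ = contradiction refl zs≢[]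
    Linked-splice xs {v} ys {z ∷ zs} l lzs _ enter leave with Linked-++⁻ xs l
    ... | lxs , into-v , lvys =
      Linked.++⁺ lxs (into (last xs) refl into-v) (Linked.++⁺ lzs out (Linked.tail lvys))
      where
      into : ∀ m → last xs ≡ m → Connected R m (just v) → Connected R m (just z)
      into nothing  _  _       = nothing-just
      into (just x) eq (just r) = just (enter (last-∈ xs eq) (here refl) r)
      out : Connected R (last (z ∷ zs)) (head ys)
      out with last (z ∷ zs) in eq
      ... | nothing = Connected-nothingˡ
      ... | just z′ = onward ys lvys λ y∈ys → leave y∈ys (last-∈ (z ∷ zs) eq)
        where
        onward : ∀ ys′ → Linked R (v ∷ ys′) → (∀ {y} → y ∈ ys′ → R v y → R z′ y) →
                 Connected R (just z′) (head ys′)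
        onward []      _       _    = just-nothing
        onward (_ ∷ _) (r ∷ _) v⇒z′ = just (v⇒z′ (here refl) r)

module _ {n : ℕ} where

  ∣p∣≤1⇒≡ : ∀ {p : Subset n} {x y} → ∣ p ∣ ≤ 1 → x ∈ₛ p → y ∈ₛ p → x ≡ y
  ∣p∣≤1⇒≡ {p} {x} {y} ∣p∣≤1 x∈p y∈p with x ≟ y
  ... | yes x≡y = x≡y
  ... | no  x≢y = contradiction ∣p∣≤1 (<⇒≱ (subst (_< ∣ p ∣) (∣⁅x⁆∣≡1 x) (p⊂q⇒∣p∣<∣q∣ ⁅x⁆⊂p)))
    where
    ⁅x⁆⊂p : ⁅ x ⁆ ⊂ p
    ⁅x⁆⊂p = (λ z∈⁅x⁆ → subst (_∈ₛ p) (sym (x∈⁅y⁆⇒x≡y x z∈⁅x⁆)) x∈p) ,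
            y , y∈p , x≢y⇒x∉⁅y⁆ (x≢y ∘ sym)

  2≤∣p∣⇒∃≢ : ∀ {p : Subset n} → 2 ≤ ∣ p ∣ → ∀ x → ∃ λ y → y ∈ₛ p × y ≢ x
  2≤∣p∣⇒∃≢ {p} 2≤∣p∣ x with any? (λ y → y ∈? p ×-dec ¬? (y ≟ x))
  ... | yes found = found
  ... | no  none  =
    contradiction (subst (∣ p ∣ ≤_) (∣⁅x⁆∣≡1 x) (p⊆q⇒∣p∣≤∣q∣ p⊆⁅x⁆)) (<⇒≱ 2≤∣p∣)
    where
    p⊆⁅x⁆ : p ⊆ ⁅ x ⁆
    p⊆⁅x⁆ {y} y∈p with y ≟ x
    ... | yes refl = x∈⁅x⁆ x
    ... | no  y≢x  = contradiction (y , y∈p , y≢x) none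

  0<∣p∣⇒Nonempty : ∀ {p : Subset n} → 0 < ∣ p ∣ → Nonempty p
  0<∣p∣⇒Nonempty {p} 0<∣p∣ with nonempty? p
  ... | yes p≠∅ = p≠∅
  ... | no  p=∅ = contradiction (trans (cong ∣_∣ (Empty-unique p=∅)) (∣⊥∣≡0 n)) (>⇒≢ 0<∣p∣)

  ∣p∩q∣≤1⇒p∩q⊆⁅x⁆ : ∀ {p q : Subset n} → Nonempty p → ∣ p ∩ q ∣ ≤ 1 →
                    ∃ λ x → x ∈ₛ p × p ∩ q ⊆ ⁅ x ⁆
  ∣p∩q∣≤1⇒p∩q⊆⁅x⁆ {p} {q} (x , x∈p) ∣p∩q∣≤1 with nonempty? (p ∩ q)
  ... | no  none         = x , x∈p , λ y∈p∩q → contradiction (_ , y∈p∩q) none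
  ... | yes (y , y∈p∩q) = y , proj₁ (x∈p∩q⁻ p q y∈p∩q) , λ z∈p∩q →
    subst (_∈ₛ ⁅ y ⁆) (sym (∣p∣≤1⇒≡ ∣p∩q∣≤1 z∈p∩q y∈p∩q)) (x∈⁅x⁆ y)

  collapse : Subset n → Fin n → Subset n
  collapse Y v = ∁ Y ∪ ⁅ v ⁆

  v∈collapse : ∀ Y v → v ∈ₛ collapse Y v
  v∈collapse Y v = x∈p∪q⁺ (inj₂ (x∈⁅x⁆ v))

  ∉⇒∈collapse : ∀ {Y w} v → w ∉ₛ Y → w ∈ₛ collapse Y v
  ∉⇒∈collapse v w∉Y = x∈p∪q⁺ (inj₁ (x∉p⇒x∈∁p w∉Y))

  ∈collapse⇒∉ : ∀ {Y v w} → w ∈ₛ collapse Y v → w ≢ v → w ∉ₛ Y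
  ∈collapse⇒∉ {Y} {v} w∈ w≢v with x∈p∪q⁻ (∁ Y) ⁅ v ⁆ w∈
  ... | inj₁ w∈∁Y = x∈∁p⇒x∉p w∈∁Y
  ... | inj₂ w∈⁅v⁆ = contradiction (x∈⁅y⁆⇒x≡y v w∈⁅v⁆) w≢v

  collapse⊂⊤ : ∀ {Y v w} → w ∈ₛ Y → w ≢ v → collapse Y v ⊂ ⊤
  collapse⊂⊤ {w = w} w∈Y w≢v = (λ _ → ∈⊤) , w , ∈⊤ , λ w∈ → ∈collapse⇒∉ w∈ w≢v w∈Y

  ⊆collapse : ∀ {Y v p} → Y ∩ p ⊆ ⁅ v ⁆ → p ⊆ collapse Y v
  ⊆collapse {Y} {v} Y∩p⊆⁅v⁆ {w} w∈p with w ∈? Y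
  ... | yes w∈Y =
    subst (_∈ₛ collapse Y v) (sym (x∈⁅y⁆⇒x≡y v (Y∩p⊆⁅v⁆ (x∈p∩q⁺ (w∈Y , w∈p))))) (v∈collapse Y v)
  ... | no  w∉Y = ∉⇒∈collapse v w∉Y

module _ {n : ℕ} (D : Digraph n) where
  open Digraph D

  IsModule : Subset n → Set
  IsModule Y = ∀ {x u w} → x ∉ₛ Y → u ∈ₛ Y → w ∈ₛ Y →
               (Arc x u → Arc x w) × (Arc u x → Arc w x)

  ↦-middle-isModule : ∀ {V₁ V₂ V₃} → Partition3 D V₁ V₂ V₃ →
                      _↦_ D V₁ V₂ → _↦_ D V₂ V₃ → IsModule V₂
  ↦-middle-isModule part V₁↦V₂ V₂↦V₃ {x} {u} {w} x∉V₂ u∈V₂ w∈V₂ with part x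
  ... | inj₁ (x∈V₁ , _) =
    (λ _ → proj₁ (V₁↦V₂ x w x∈V₁ w∈V₂)) , λ u→x → contradiction u→x (proj₂ (V₁↦V₂ x u x∈V₁ u∈V₂))
  ... | inj₂ (inj₁ (_ , x∈V₂ , _)) = contradiction x∈V₂ x∉V₂
  ... | inj₂ (inj₂ (_ , _ , x∈V₃)) =
    (λ x→u → contradiction x→u (proj₂ (V₂↦V₃ u x u∈V₂ x∈V₃))) , λ _ → proj₁ (V₂↦V₃ w x w∈V₂ x∈V₃)

  MaxStable-restrict : ∀ {X S} → MaxStable D ⊤ S → S ⊆ X → MaxStable D X S
  MaxStable-restrict ((_ , S-stable) , S-max) S⊆X =
    (S⊆X , S-stable) , λ T (_ , T-stable) → S-max T ((λ _ → ∈⊤) , T-stable)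

  HamiltonianPath : Subset n → List (Fin n) → Set
  HamiltonianPath Y P = IsPath D P × (∀ w → w ∈ P ⇔ w ∈ₛ Y)

  HamiltonianCycle : Subset n → List (Fin n) → Set
  HamiltonianCycle Y C = ExactlyCovers D C Y × Linked Arc C × Connected Arc (last C) (head C)

  Hamiltonian⇒HamiltonianCycle : ∀ {Y} → Hamiltonian D Y → ∃ (HamiltonianCycle Y)
  Hamiltonian⇒HamiltonianCycle (C , covers , linked , _ , _ , head≡a , last≡b , b→a) =
    C , covers , linked , subst₂ (Connected Arc) (sym last≡b) (sym head≡a) (just b→a)

  HamiltonianCycle-rotate : ∀ {Y} xs ys → ys ++ xs ≢ [] →
                            HamiltonianCycle Y (xs ++ ys) → HamiltonianPath Y (ys ++ xs)
  HamiltonianCycle-rotate xs ys ≢[] ((unique , ∈⇔) , linked , closing) =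
    (≢[] , Unique-++-comm xs unique , Linked-rotate xs linked closing) ,
    λ w → mk⇔ (to (∈⇔ w) ∘ Any.++-comm ys xs) (Any.++-comm xs ys ∘ from (∈⇔ w))

  Hamiltonian⇒path-from : ∀ {Y v} → Hamiltonian D Y → v ∈ₛ Y →
                          ∃ λ P → HamiltonianPath Y P × head P ≡ just v
  Hamiltonian⇒path-from {v = v} ham v∈Y with Hamiltonian⇒HamiltonianCycle ham
  ... | _ , cycle@((_ , ∈⇔) , _) with ∈-∃++ (from (∈⇔ v) v∈Y)
  ... | xs , ys , refl = (v ∷ ys) ++ xs , HamiltonianCycle-rotate xs (v ∷ ys) (λ ()) cycle , refl

  Hamiltonian⇒path-to : ∀ {Y v} → Hamiltonian D Y → v ∈ₛ Y →
                        ∃ λ P → HamiltonianPath Y P × last P ≡ just v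
  Hamiltonian⇒path-to {Y} {v} ham v∈Y with Hamiltonian⇒HamiltonianCycle ham
  ... | _ , cycle@((_ , ∈⇔) , _) with ∈-∃++ (from (∈⇔ v) v∈Y)
  ... | xs , ys , refl =
    ys ++ xs ++ [ v ] ,
    HamiltonianCycle-rotate (xs ++ [ v ]) ys ≢[]
      (subst (HamiltonianCycle Y) (sym (++-assoc xs [ v ] ys)) cycle) ,
    trans (cong last (sym (++-assoc ys xs [ v ]))) (last-++-∷ (ys ++ xs) [])
    where
    ≢[] : ys ++ xs ++ [ v ] ≢ []
    ≢[] eq = contradiction (++-conicalʳ xs [ v ] (++-conicalʳ ys _ eq)) λ ()

  UniqueSIn-splice : ∀ {S v zs s} xs ys → v ∈ zs → (∀ {t} → t ∈ zs → t ∈ₛ S → t ≡ v) →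
                     UniqueSIn D S (xs ++ v ∷ ys) s → UniqueSIn D S (xs ++ zs ++ ys) s
  UniqueSIn-splice {S} {v} {zs} xs ys v∈zs zs∩S⊆v (s∈S , s∈ , only-s) =
    s∈S , ∈-splice⁺ xs v∈zs s∈ ,
    λ t t∈S t∈ → [ only-s t t∈S ∘ ∈-++-∷⁺ xs , only-s t t∈S ∘ via-v t∈S ]′ (∈-splice⁻ xs zs t∈)
    where
    via-v : ∀ {t} → t ∈ₛ S → t ∈ zs → t ∈ xs ++ v ∷ ys
    via-v t∈S t∈zs = subst (_∈ xs ++ v ∷ ys) (sym (zs∩S⊆v t∈zs t∈S)) (∈-++⁺ʳ xs (here refl))

  PathPartition-splice : ∀ {Y v P} Ps₁ xs ys Ps₂ → IsModule Y → v ∈ₛ Y → HamiltonianPath Y P →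
                         PathPartition D (collapse Y v) (Ps₁ ++ (xs ++ v ∷ ys) ∷ Ps₂) →
                         PathPartition D ⊤ (Ps₁ ++ (xs ++ P ++ ys) ∷ Ps₂)
  PathPartition-splice {Y} {v} {P} Ps₁ xs ys Ps₂ Y-module v∈Y
                       ((P≢[] , P-unique , P-linked) , P⇔Y) (paths , unique , ∈⇔) =
    All-replace Ps₁ paths path , unique′ , λ w → mk⇔ (λ _ → ∈⊤) (λ _ → covered w)
    where
    before after : List (Fin n)
    before = concat Ps₁ ++ xs
    after  = ys ++ concat Ps₂

    old≡ : concat (Ps₁ ++ (xs ++ v ∷ ys) ∷ Ps₂) ≡ before ++ v ∷ after
    old≡ = concat-splice Ps₁ xs [ v ] ys Ps₂

    new≡ : concat (Ps₁ ++ (xs ++ P ++ ys) ∷ Ps₂) ≡ before ++ P ++ after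
    new≡ = concat-splice Ps₁ xs P ys Ps₂

    old-unique : Unique (before ++ v ∷ after)
    old-unique = subst Unique old≡ unique

    outside : ∀ {w} → w ∈ before ++ after → w ∉ₛ Y
    outside {w} w∈ = ∈collapse⇒∉ (to (∈⇔ w) (subst (w ∈_) (sym old≡) (∈-++-∷⁺ before w∈)))
                                 λ { refl → Unique-++-∷⇒∉ before old-unique w∈ }

    inner : ∀ {w} → w ∈ xs ++ ys → w ∈ before ++ after
    inner w∈ = [ ∈-++⁺ˡ ∘ ∈-++⁺ʳ (concat Ps₁) , ∈-++⁺ʳ before ∘ ∈-++⁺ˡ ]′ (∈-++⁻ xs w∈)

    P-disjoint : ∀ {zs} → (∀ {w} → w ∈ zs → w ∉ₛ Y) → Disjoint zs P
    P-disjoint zs∌Y (w∈zs , w∈P) = zs∌Y w∈zs (to (P⇔Y _) w∈P)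

    path : IsPath D (xs ++ P ++ ys)
    path with All.lookup paths (∈-++⁺ʳ Ps₁ (here refl))
    ... | _ , old-path-unique , old-path-linked =
      (λ eq → P≢[] (++-conicalˡ P ys (++-conicalʳ xs _ eq))) ,
      Unique-splice xs old-path-unique P-unique (P-disjoint (outside ∘ inner)) ,
      Linked-splice xs ys old-path-linked P-linked P≢[]
        (λ x∈xs z∈P → proj₁ (Y-module (outside (inner (∈-++⁺ˡ x∈xs))) v∈Y (to (P⇔Y _) z∈P)))
        (λ y∈ys z∈P → proj₂ (Y-module (outside (inner (∈-++⁺ʳ xs y∈ys))) v∈Y (to (P⇔Y _) z∈P)))

    unique′ : Unique (concat (Ps₁ ++ (xs ++ P ++ ys) ∷ Ps₂))
    unique′ = subst Unique (sym new≡) (Unique-splice before old-unique P-unique (P-disjoint outside))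

    covered : ∀ w → w ∈ concat (Ps₁ ++ (xs ++ P ++ ys) ∷ Ps₂)
    covered w with w ∈? Y
    ... | yes w∈Y = subst (w ∈_) (sym new≡) (∈-++⁺ʳ before (∈-++⁺ˡ (from (P⇔Y w) w∈Y)))
    ... | no  w∉Y = subst (w ∈_) (sym new≡)
                      (∈-splice⁺ before (from (P⇔Y v) v∈Y)
                        (subst (w ∈_) old≡ (from (∈⇔ w) (∉⇒∈collapse v w∉Y))))

module Reduction {n} (D : Digraph n) (S Y : Subset n)
  (S-max : MaxStable D ⊤ S) (Y-module : IsModule D Y) (Y-hamiltonian : Hamiltonian D Y)
  (2≤∣Y∣ : 2 ≤ ∣ Y ∣) (∣Y∩S∣≤1 : ∣ Y ∩ S ∣ ≤ 1) where

  private
    representative : ∃ λ v → v ∈ₛ Y × Y ∩ S ⊆ ⁅ v ⁆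
    representative = ∣p∩q∣≤1⇒p∩q⊆⁅x⁆ (0<∣p∣⇒Nonempty (<⇒≤ 2≤∣Y∣)) ∣Y∩S∣≤1

    v : Fin n
    v = proj₁ representative

    v∈Y : v ∈ₛ Y
    v∈Y = proj₁ (proj₂ representative)

    Y∩S⊆⁅v⁆ : Y ∩ S ⊆ ⁅ v ⁆
    Y∩S⊆⁅v⁆ = proj₂ (proj₂ representative)

  X : Subset n
  X = collapse Y v

  X⊂⊤ : X ⊂ ⊤
  X⊂⊤ with 2≤∣p∣⇒∃≢ 2≤∣Y∣ v
  ... | w , w∈Y , w≢v = collapse⊂⊤ w∈Y w≢v

  private
    S-max-in-X : MaxStable D X S
    S-max-in-X = MaxStable-restrict D S-max (⊆collapse Y∩S⊆⁅v⁆)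

    split-at-v : ∀ {Ps} → PathPartition D X Ps →
                 ∃ λ Ps₁ → ∃ λ Ps₂ → ∃ λ xs → ∃ λ ys → Ps ≡ Ps₁ ++ (xs ++ v ∷ ys) ∷ Ps₂
    split-at-v {Ps} (_ , _ , ∈⇔) = ∈-concat⇒split Ps (from (∈⇔ v) (v∈collapse Y v))

    splice-S : ∀ {P s} xs ys → HamiltonianPath D Y P →
               UniqueSIn D S (xs ++ v ∷ ys) s → UniqueSIn D S (xs ++ P ++ ys) s
    splice-S xs ys (_ , P⇔Y) = UniqueSIn-splice D xs ys (from (P⇔Y v) v∈Y)
      λ t∈P t∈S → x∈⁅y⁆⇒x≡y v (Y∩S⊆⁅v⁆ (x∈p∩q⁺ (to (P⇔Y _) t∈P , t∈S)))

  BE-case : BEProperty D X → ∃ (SBEPathPartition D ⊤ S)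
  BE-case BE with BE S S-max-in-X
  ... | Ps , partition , BE-paths with split-at-v partition
  ... | Ps₁ , Ps₂ , xs , ys , refl with All.lookup BE-paths (∈-++⁺ʳ Ps₁ (here refl))
  ... | s , s-only , inj₁ s-first =
    let P , P-ham , P-from-v = Hamiltonian⇒path-from D Y-hamiltonian v∈Y in
    _ , PathPartition-splice D Ps₁ xs ys Ps₂ Y-module v∈Y P-ham partition ,
    All-replace Ps₁ BE-paths
      (s , splice-S xs ys P-ham s-only , inj₁ (trans (head-splice xs P-from-v) s-first))
  ... | s , s-only , inj₂ s-last =
    let P , P-ham , P-to-v = Hamiltonian⇒path-to D Y-hamiltonian v∈Y in
    _ , PathPartition-splice D Ps₁ xs ys Ps₂ Y-module v∈Y P-ham partition ,
    All-replace Ps₁ BE-paths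
      (s , splice-S xs ys P-ham s-only , inj₂ (trans (last-splice xs ys P-to-v) s-last))

  α-case : AlphaProperty D X → ∃ (SPathPartition D ⊤ S)
  α-case α with α S S-max-in-X
  ... | Ps , partition , α-paths with split-at-v partition
  ... | Ps₁ , Ps₂ , xs , ys , refl with All.lookup α-paths (∈-++⁺ʳ Ps₁ (here refl))
  ... | s , s-only =
    let P , P-ham , _ = Hamiltonian⇒path-from D Y-hamiltonian v∈Y in
    _ , PathPartition-splice D Ps₁ xs ys Ps₂ Y-module v∈Y P-ham partition ,
    All-replace Ps₁ α-paths (s , splice-S xs ys P-ham s-only)

lemma5 : ∀ {n : ℕ} (D : Digraph n) →
    (AllProperSub D (BEProperty D) →
      ∀ (S V₁ V₂ V₃ : Subset n) → Hyp D S V₁ V₂ V₃ →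
        ∃ λ Ps → SBEPathPartition D ⊤ S Ps)
    ×
    (AllProperSub D (AlphaProperty D) →
      ∀ (S V₁ V₂ V₃ : Subset n) → Hyp D S V₁ V₂ V₃ →
        ∃ λ Ps → SPathPartition D ⊤ S Ps)
lemma5 D =
  (λ { BE S _ V₂ _ (S-max , part , V₁↦V₂ , V₂↦V₃ , ham , 2≤∣V₂∣ , ∣V₂∩S∣≤1) →
         let open Reduction D S V₂ S-max (↦-middle-isModule D part V₁↦V₂ V₂↦V₃) ham 2≤∣V₂∣ ∣V₂∩S∣≤1
         in BE-case (BE X X⊂⊤) }) ,
  (λ { α S _ V₂ _ (S-max , part , V₁↦V₂ , V₂↦V₃ , ham , 2≤∣V₂∣ , ∣V₂∩S∣≤1) →
         let open Reduction D S V₂ S-max (↦-middle-isModule D part V₁↦V₂ V₂↦V₃) ham 2≤∣V₂∣ ∣V₂∩S∣≤1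
         in α-case (α X X⊂⊤) })
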